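{- There is an absolute constant $C$ such that for the union-find data structure with union-by-size and path compression on $n$ nodes (as described in the context) and any sequence of union and find steps, \[\sum_p \frac{\textsc{Size}^{\max}(p)}{(1+\log\textsc{Size}^{\max}(p))^2}\le Cn,\] where $p$ ranges over all $n$ nodes.
   Context: The data structure maintains a rooted forest on $n$ nodes. Initially every node is its own root and has size $1$. At any time, $\textsc{Size}(p)$ is the current number of descendants of $p$, including $p$. A find step on a node $p$: let $p=p_1\to\cdots\to p_k=r$ be the path from $p$ to the root $r$; every node on the path is made a child of $r$. A union step on two roots $r_a\neq r_b$ of different trees: if $\textsc{Size}(r_a)<\textsc{Size}(r_b)$ swap them; then $r_b$ is made a child of $r_a$ and $\textsc{Size}(r_a)\leftarrow \textsc{Size}(r_a)+\textsc{Size}(r_b)$. For a fixed sequence of steps, $\textsc{Size}^{\max}(p)$ is the number of nodes that are a descendant of $p$ (including $p$) at some point of time during the whole sequence. Logarithms are base $2$. -}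

module Defs where

open import Data.Nat using (ℕ; zero; suc; _*_; _<ᵇ_)
open import Data.Nat.Logarithm using (⌊log₂_⌋)
open import Data.Fin using (Fin)
open import Data.Fin.Properties using (_≟_)
open import Data.Bool using (Bool; true; false; if_then_else_; T?)
open import Data.Bool.ListAction using (any)
open import Data.List using (List; []; _∷_; length; filter; foldr; allFin; upTo; map)
open import Data.Product using (_×_)
open import Data.Unit using (⊤)
open import Relation.Binary.PropositionalEquality using (_≡_; _≢_)
open import Relation.Nullary.Decidable using (⌊_⌋)
import Data.Integer as ℤ
import Data.Rational as ℚ

-- A state of the forest on the nodes Fin n: the parent pointer of each node.
-- A node r is a root iff its parent is itself.
Forest : ℕ → Set
Forest n = Fin n → Fin n

initial : (n : ℕ) → Forest n
initial n p = p

iter : ∀ {n} → Forest n → ℕ → Fin n → Fin n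
iter s zero    p = p
iter s (suc i) p = iter s i (s p)

-- node q lies on the path from p to the root (i.e. q is an ancestor of p,
-- p itself included); in a forest on n nodes the path has < n + 1 nodes
onPath : ∀ {n} → Forest n → Fin n → Fin n → Bool
onPath {n} s p q = any (λ i → ⌊ iter s i p ≟ q ⌋) (upTo (suc n))

isDesc : ∀ {n} → Forest n → Fin n → Fin n → Bool
isDesc s p q = onPath s q p

root : ∀ {n} → Forest n → Fin n → Fin n
root {n} s p = iter s n p

count : ∀ {n} → (Fin n → Bool) → ℕ
count {n} f = length (filter (λ q → T? (f q)) (allFin n))

size : ∀ {n} → Forest n → Fin n → ℕ
size s p = count (isDesc s p)

IsRoot : ∀ {n} → Forest n → Fin n → Set
IsRoot s r = s r ≡ r

data Op (n : ℕ) : Set where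
  find  : Fin n → Op n
  union : Fin n → Fin n → Op n

findStep : ∀ {n} → Forest n → Fin n → Forest n
findStep s p q = if onPath s p q then root s p else s q

link : ∀ {n} → Forest n → Fin n → Fin n → Forest n
link s a b q = if ⌊ q ≟ b ⌋ then a else s q

unionStep : ∀ {n} → Forest n → Fin n → Fin n → Forest n
unionStep s ra rb =
  if size s ra <ᵇ size s rb then link s rb ra else link s ra rb

step : ∀ {n} → Forest n → Op n → Forest n
step s (find p)      = findStep s p
step s (union ra rb) = unionStep s ra rb

Valid : ∀ {n} → Forest n → List (Op n) → Set
Valid s []                   = ⊤
Valid s (find p ∷ ops)       = Valid (step s (find p)) ops
Valid s (union ra rb ∷ ops)  =
  IsRoot s ra × IsRoot s rb × ra ≢ rb × Valid (step s (union ra rb)) ops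

trajectory : ∀ {n} → Forest n → List (Op n) → List (Forest n)
trajectory s []         = s ∷ []
trajectory s (o ∷ ops)  = s ∷ trajectory (step s o) ops

sizeMax : ∀ {n} → Forest n → List (Op n) → Fin n → ℕ
sizeMax s ops p = count (λ q → any (λ t → isDesc t p q) (trajectory s ops))

term : ℕ → ℚ.ℚ
term x = ℤ.+ x ℚ./ (suc ⌊log₂ x ⌋ * suc ⌊log₂ x ⌋)

potential : ∀ {n} → Forest n → List (Op n) → ℚ.ℚ
potential {n} s ops = foldr ℚ._+_ ℚ.0ℚ (map (λ p → term (sizeMax s ops p)) (allFin n))

module Submission where

-- Let V x be the subtree of x in the forest built by the unions alone, ignoring path
-- compression. Every set of descendants that x ever has lies inside the final V x, and union by
-- size makes the family laminar with doubling: two sets V x, V y are disjoint, or one contains the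
-- other and is at least twice as large. Hence the sets V x with ⌊log₂ |V x|⌋ = k are pairwise
-- disjoint of size ≥ 2^k, so at most n / 2^k nodes lie on level k, and each contributes at most
-- about 2^(k+1) / (k+1)² + 4 to the sum. As 2^(k+1) / (k+1)² · n / 2^k ≤ 4n / ((k+1)(k+2))
-- telescopes, the total is at most 8n.

open import Defs
open import Data.Fin using (Fin)
open import Relation.Binary.PropositionalEquality
  using (_≡_; _≢_; refl; sym; trans; cong; cong₂; subst; subst₂; module ≡-Reasoning)

module ReferenceForest where

  open import Data.Bool using (Bool; true; false; _∨_; if_then_else_; T; T?)
  open import Data.Bool.Properties using (T-∨; T-≡)
  open import Data.Bool.ListAction using (any)
  open import Data.Empty using (⊥; ⊥-elim)
  open import Data.Fin.Properties using (_≟_)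
  open import Data.List using (List; []; _∷_; length; filter; allFin; upTo)
  open import Data.List.Membership.Propositional using (_∈_; lose) renaming (find to find-∈)
  open import Data.List.Membership.Propositional.Properties using (∈-allFin; ∈-upTo⁺; ∈-upTo⁻)
  open import Data.List.Properties using (length-filter; length-tabulate)
  open import Data.List.Relation.Unary.Any using (here; there)
  open import Data.List.Relation.Unary.Any.Properties using (any⁺; any⁻)
  open import Data.Nat as ℕ using (ℕ; zero; suc; _+_; _*_; _∸_; _≤_; _<_; _<ᵇ_; z≤n; s≤s)
  open import Data.Nat.Properties as ℕP using (≤-refl; ≤-trans; ≤-reflexive; ≤-antisym; +-suc; m≤n⇒m≤1+n)
  open import Data.Product using (∃-syntax; _×_; _,_; proj₁; proj₂)
  open import Data.Sum using (_⊎_; inj₁; inj₂; [_,_])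
  open import Function using (_∘_; id; Equivalence)
  open import Relation.Nullary using (¬_; yes; no; Dec)
  open import Relation.Nullary.Decidable using (⌊_⌋; toWitness; fromWitness)

  countIn : {A : Set} → List A → (A → Bool) → ℕ
  countIn xs f = length (filter (λ q → T? (f q)) xs)

  module _ {A : Set} where

    countIn-∷ : ∀ (x : A) xs f → countIn (x ∷ xs) f ≡ (if f x then suc (countIn xs f) else countIn xs f)
    countIn-∷ x xs f with f x
    ... | true  = refl
    ... | false = refl

    countIn-mono : ∀ (xs : List A) {f g : A → Bool} → (∀ {a} → T (f a) → T (g a)) → countIn xs f ≤ countIn xs g
    countIn-mono []       f⇒g = z≤n
    countIn-mono (x ∷ xs) {f} {g} f⇒g rewrite countIn-∷ x xs f | countIn-∷ x xs g with f x in fx | g x in gx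
    ... | true  | true  = s≤s (countIn-mono xs f⇒g)
    ... | true  | false = ⊥-elim (subst T gx (f⇒g (subst T (sym fx) _)))
    ... | false | true  = m≤n⇒m≤1+n (countIn-mono xs f⇒g)
    ... | false | false = countIn-mono xs f⇒g

    countIn-∨ : ∀ (xs : List A) (f g : A → Bool) → (∀ {a} → T (f a) → T (g a) → ⊥) →
                countIn xs (λ a → f a ∨ g a) ≡ countIn xs f + countIn xs g
    countIn-∨ []       f g disj = refl
    countIn-∨ (x ∷ xs) f g disj rewrite countIn-∷ x xs (λ a → f a ∨ g a) | countIn-∷ x xs f | countIn-∷ x xs g
      with f x in fx | g x in gx
    ... | true  | true  = ⊥-elim (disj (subst T (sym fx) _) (subst T (sym gx) _))
    ... | true  | false = cong suc (countIn-∨ xs f g disj)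
    ... | false | true  = trans (cong suc (countIn-∨ xs f g disj)) (sym (+-suc _ _))
    ... | false | false = countIn-∨ xs f g disj

    countIn-pos : ∀ {xs : List A} {f x} → x ∈ xs → T (f x) → 1 ≤ countIn xs f
    countIn-pos {y ∷ xs} {f} (here refl) fx rewrite countIn-∷ y xs f with f y
    ... | true = s≤s z≤n
    countIn-pos {y ∷ xs} {f} (there x∈xs) fx rewrite countIn-∷ y xs f with f y
    ... | true  = s≤s z≤n
    ... | false = countIn-pos x∈xs fx

  NodeSet : ℕ → Set
  NodeSet n = Fin n → Bool

  module _ {n : ℕ} where

    infix 4 _∈ₛ_ _⊆_ _≪_

    _∈ₛ_ : Fin n → NodeSet n → Set
    q ∈ₛ X = T (X q)

    _⊆_ : NodeSet n → NodeSet n → Set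
    X ⊆ Y = ∀ {q} → q ∈ₛ X → q ∈ₛ Y

    ∣_∣ : NodeSet n → ℕ
    ∣ X ∣ = count X

    Disjoint : NodeSet n → NodeSet n → Set
    Disjoint X Y = ∀ {q} → q ∈ₛ X → q ∈ₛ Y → ⊥

    _∪_ : NodeSet n → NodeSet n → NodeSet n
    (X ∪ Y) q = X q ∨ Y q

    _≪_ : NodeSet n → NodeSet n → Set
    X ≪ Y = X ⊆ Y × 2 * ∣ X ∣ ≤ ∣ Y ∣

    Nested : NodeSet n → NodeSet n → Set
    Nested X Y = Disjoint X Y ⊎ X ≪ Y ⊎ Y ≪ X

    ∣∣-mono : ∀ {X Y} → X ⊆ Y → ∣ X ∣ ≤ ∣ Y ∣
    ∣∣-mono = countIn-mono (allFin n)

    ∣∣≤n : ∀ X → ∣ X ∣ ≤ n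
    ∣∣≤n X = ≤-trans (length-filter _ (allFin n)) (≤-reflexive (length-tabulate id))

    ∣∣-pos : ∀ X {q} → q ∈ₛ X → 1 ≤ ∣ X ∣
    ∣∣-pos X {q} = countIn-pos (∈-allFin q)

    ∣∪∣ : ∀ {X Y} → Disjoint X Y → ∣ X ∪ Y ∣ ≡ ∣ X ∣ + ∣ Y ∣
    ∣∪∣ {X} {Y} = countIn-∨ (allFin n) X Y

    ∪-⊇ˡ : ∀ {X Y} → X ⊆ X ∪ Y
    ∪-⊇ˡ = Equivalence.from T-∨ ∘ inj₁

    ∪-⊇ʳ : ∀ {X Y} → Y ⊆ X ∪ Y
    ∪-⊇ʳ = Equivalence.from T-∨ ∘ inj₂

    ∪-cases : ∀ {X Y q} → q ∈ₛ X ∪ Y → q ∈ₛ X ⊎ q ∈ₛ Y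
    ∪-cases = Equivalence.to T-∨

    ≪-⊆-trans : ∀ {X Y Z} → X ≪ Y → Y ⊆ Z → X ≪ Z
    ≪-⊆-trans (X⊆Y , X≤½Y) Y⊆Z = Y⊆Z ∘ X⊆Y , ≤-trans X≤½Y (∣∣-mono Y⊆Z)

    ≪-⊇-impossible : ∀ {X Y q} → q ∈ₛ X → X ≪ Y → Y ⊆ X → ⊥
    ≪-⊇-impossible {X} {Y} q∈X (_ , X≤½Y) Y⊆X = ℕP.<-irrefl refl (begin-strict
      ∣ X ∣             <⟨ ℕP.m<n+m ∣ X ∣ (∣∣-pos X q∈X) ⟩
      ∣ X ∣ + ∣ X ∣     ≡⟨ cong (∣ X ∣ +_) (sym (ℕP.+-identityʳ ∣ X ∣)) ⟩
      2 * ∣ X ∣         ≤⟨ X≤½Y ⟩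
      ∣ Y ∣             ≤⟨ ∣∣-mono Y⊆X ⟩
      ∣ X ∣             ∎)
      where open ℕP.≤-Reasoning

    Nested-sym : ∀ {X Y} → Nested X Y → Nested Y X
    Nested-sym (inj₁ disj)        = inj₁ (λ y x → disj x y)
    Nested-sym (inj₂ (inj₁ X≪Y)) = inj₂ (inj₂ X≪Y)
    Nested-sym (inj₂ (inj₂ Y≪X)) = inj₂ (inj₁ Y≪X)

  module _ {n : ℕ} (s : Forest n) where

    iter-+ : ∀ i j q → iter s (i + j) q ≡ iter s j (iter s i q)
    iter-+ zero    j q = refl
    iter-+ (suc i) j q = iter-+ i j (s q)

    iter-root : ∀ {r} → IsRoot s r → ∀ i → iter s i r ≡ r
    iter-root r-root zero    = refl
    iter-root r-root (suc i) rewrite r-root = iter-root r-root i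

    onPath⇒iter : ∀ {p q} → T (onPath s p q) → ∃[ i ] i ≤ n × iter s i p ≡ q
    onPath⇒iter on with i , i∈ , hit ← find-∈ (any⁻ _ (upTo (suc n)) on) =
      i , ℕP.≤-pred (∈-upTo⁻ i∈) , toWitness hit

    iter⇒onPath : ∀ {p q} i → i ≤ n → iter s i p ≡ q → T (onPath s p q)
    iter⇒onPath i i≤n hit = any⁺ _ (lose (∈-upTo⁺ (s≤s i≤n)) (fromWitness hit))

    iter-to-root : ∀ {p} i → i ≤ n → iter s (n ∸ i) (iter s i p) ≡ root s p
    iter-to-root {p} i i≤n = begin
      iter s (n ∸ i) (iter s i p) ≡⟨ iter-+ i (n ∸ i) p ⟨
      iter s (i + (n ∸ i)) p      ≡⟨ cong (λ k → iter s k p) (ℕP.m+[n∸m]≡n i≤n) ⟩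
      root s p                    ∎
      where open ≡-Reasoning

    root⇒isDesc : ∀ {r q} → root s q ≡ r → T (isDesc s r q)
    root⇒isDesc = iter⇒onPath n ≤-refl

  record Doubling {n} (s : Forest n) (V : Fin n → NodeSet n) : Set where
    field
      self     : ∀ x → x ∈ₛ V x
      parent-≪ : ∀ {z} → s z ≢ z → V z ≪ V (s z)

  module DoublingProperties {n} {s : Forest n} {V : Fin n → NodeSet n} (dbl : Doubling s V) where
    open Doubling dbl

    ancestor-⊆ : ∀ i q → V q ⊆ V (iter s i q)
    ancestor-⊆ zero    q = id
    ancestor-⊆ (suc i) q with s q ≟ q
    ... | yes q-root rewrite q-root = ancestor-⊆ i q
    ... | no  q≢root = ancestor-⊆ i (s q) ∘ proj₁ (parent-≪ q≢root)

    ancestor-≪ : ∀ i q → iter s i q ≢ q → V q ≪ V (iter s i q)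
    ancestor-≪ zero    q moved = ⊥-elim (moved refl)
    ancestor-≪ (suc i) q moved with s q ≟ q
    ... | yes q-root = ⊥-elim (moved (trans (cong (iter s i) q-root) (iter-root s q-root i)))
    ... | no  q≢root = ≪-⊆-trans (parent-≪ q≢root) (ancestor-⊆ i (s q))

    -- root follows n parent pointers; |V| at least doubles along each of them and stays ≤ n,
    -- so a root is met within n steps
    climb : ∀ i q → IsRoot s (iter s i q) ⊎ i + ∣ V q ∣ ≤ ∣ V (iter s i q) ∣
    climb zero    q = inj₂ ≤-refl
    climb (suc i) q with s q ≟ q
    ... | yes q-root = inj₁ (subst (IsRoot s) (sym (trans (cong (iter s i) q-root) (iter-root s q-root i))) q-root)
    ... | no  q≢root with climb i (s q)
    ...   | inj₁ at-root = inj₁ at-root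
    ...   | inj₂ grown   = inj₂ (begin
      suc i + ∣ V q ∣         ≡⟨ +-suc i ∣ V q ∣ ⟨
      i + (1 + ∣ V q ∣)       ≤⟨ ℕP.+-monoʳ-≤ i (ℕP.+-monoˡ-≤ ∣ V q ∣ (∣∣-pos (V q) (self q))) ⟩
      i + (∣ V q ∣ + ∣ V q ∣) ≡⟨ cong (λ k → i + (∣ V q ∣ + k)) (ℕP.+-identityʳ ∣ V q ∣) ⟨
      i + 2 * ∣ V q ∣         ≤⟨ ℕP.+-monoʳ-≤ i (proj₂ (parent-≪ q≢root)) ⟩
      i + ∣ V (s q) ∣         ≤⟨ grown ⟩
      ∣ V (iter s i (s q)) ∣  ∎)
      where open ℕP.≤-Reasoning

    root-isRoot : ∀ q → IsRoot s (root s q)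
    root-isRoot q with climb n q
    ... | inj₁ at-root = at-root
    ... | inj₂ grown   = ⊥-elim (ℕP.<⇒≱ (ℕP.m<m+n n (∣∣-pos (V q) (self q))) (≤-trans grown (∣∣≤n _)))

    root-parent : ∀ z → root s (s z) ≡ root s z
    root-parent z = begin
      iter s (1 + n) z ≡⟨ cong (λ k → iter s k z) (ℕP.+-comm 1 n) ⟩
      iter s (n + 1) z ≡⟨ iter-+ s n 1 z ⟩
      s (root s z)     ≡⟨ root-isRoot z ⟩
      root s z         ∎
      where open ≡-Reasoning

    root-unique : (ρ : Fin n → Fin n) → (∀ z → ρ (s z) ≡ ρ z) → (∀ {r} → IsRoot s r → ρ r ≡ r) →
                  ∀ q → root s q ≡ ρ q
    root-unique ρ ρ-parent ρ-root q = trans (sym (ρ-root (root-isRoot q))) (ρ-iter n q)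
      where
      ρ-iter : ∀ i q → ρ (iter s i q) ≡ ρ q
      ρ-iter zero    q = refl
      ρ-iter (suc i) q = trans (ρ-iter i (s q)) (ρ-parent q)

    root-iter : ∀ i q → root s (iter s i q) ≡ root s q
    root-iter zero    q = refl
    root-iter (suc i) q = trans (root-iter i (s q)) (root-parent q)

    isDesc⇒∈ : ∀ {x q} → T (isDesc s x q) → q ∈ₛ V x
    isDesc⇒∈ {x} {q} desc with i , _ , hit ← onPath⇒iter s desc =
      subst (λ y → q ∈ₛ V y) hit (ancestor-⊆ i q (self q))

  record ReferenceSubtrees {n} (s : Forest n) (V : Fin n → NodeSet n) : Set where
    field
      doubling    : Doubling s V
      root-owns   : ∀ {r q} → IsRoot s r → q ∈ₛ V r → root s q ≡ r
      nested      : ∀ {x y} → x ≢ y → Nested (V x) (V y)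

    open Doubling doubling public
    open DoublingProperties doubling public

    size-root : ∀ {r} → IsRoot s r → size s r ≡ ∣ V r ∣
    size-root {r} r-root =
      ≤-antisym (∣∣-mono {X = isDesc s r} isDesc⇒∈) (∣∣-mono {Y = isDesc s r} (root⇒isDesc s ∘ root-owns r-root))

    ∣∣-≤-size : ∀ {a b} → IsRoot s a → IsRoot s b → size s a ≤ size s b → ∣ V a ∣ ≤ ∣ V b ∣
    ∣∣-≤-size a-root b-root = subst₂ _≤_ (size-root a-root) (size-root b-root)

    roots-disjoint : ∀ {x y} → IsRoot s x → IsRoot s y → x ≢ y → Disjoint (V x) (V y)
    roots-disjoint x-root y-root x≢y q∈x q∈y = x≢y (trans (sym (root-owns x-root q∈x)) (root-owns y-root q∈y))

    root-maximal : ∀ {r v} → IsRoot s r → ¬ (V r ≪ V v)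
    root-maximal {r} {v} r-root r≪v = ≪-⊇-impossible (self r) r≪v v⊆r
      where
      top≡r : root s v ≡ r
      top≡r = trans (sym (root-owns (root-isRoot v) (ancestor-⊆ n v (proj₁ r≪v (self r))))) (iter-root s r-root n)
      v⊆r : V v ⊆ V r
      v⊆r = subst (λ t → V v ⊆ V t) top≡r (ancestor-⊆ n v)

  findStep-preserves : ∀ {n} {s : Forest n} {V} → ReferenceSubtrees s V → ∀ p → ReferenceSubtrees (findStep s p) V
  findStep-preserves {n} {s} {V} inv p = record
    { doubling  = doubling′
    ; root-owns = λ r-root q∈r → trans (root-same _) (root-owns (root-kept r-root) q∈r)
    ; nested    = nested
    }
    where
    open ReferenceSubtrees inv

    s′ : Forest n
    s′ = findStep s p

    top : Fin n
    top = root s p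

    on-path : ∀ {q} → onPath s p q ≡ true → ∃[ i ] iter s i p ≡ q × iter s (n ∸ i) q ≡ top
    on-path on with i , i≤n , hit ← onPath⇒iter s (Equivalence.from T-≡ on) =
      i , hit , trans (cong (iter s (n ∸ i)) (sym hit)) (iter-to-root s i i≤n)

    parent-≪′ : ∀ {z} → s′ z ≢ z → V z ≪ V (s′ z)
    parent-≪′ {z} moved with onPath s p z in on
    ... | true  = let i , _ , to-top = on-path on in
                  subst (λ t → V z ≪ V t) to-top (ancestor-≪ (n ∸ i) z (moved ∘ trans (sym to-top)))
    ... | false = parent-≪ moved

    doubling′ : Doubling s′ V
    doubling′ = record { self = self ; parent-≪ = parent-≪′ }

    root-kept : ∀ {r} → IsRoot s′ r → IsRoot s r
    root-kept {r} r-root with onPath s p r in on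
    ... | true  = subst (IsRoot s) r-root (root-isRoot p)
    ... | false = r-root

    root-parent′ : ∀ z → root s (s′ z) ≡ root s z
    root-parent′ z with onPath s p z in on
    ... | true  = let i , hit , _ = on-path on in
                  trans (iter-root s (root-isRoot p) n) (trans (sym (root-iter i p)) (cong (root s) hit))
    ... | false = root-parent z

    root-same : ∀ q → root s′ q ≡ root s q
    root-same = DoublingProperties.root-unique doubling′ (root s) root-parent′
                                               (λ r-root → iter-root s (root-kept r-root) n)

  merge : ∀ {n} → (Fin n → NodeSet n) → Fin n → Fin n → Fin n → NodeSet n
  merge V x y z = if ⌊ z ≟ x ⌋ then V x ∪ V y else V z

  module LinkPreserves {n} {s : Forest n} {V : Fin n → NodeSet n} (inv : ReferenceSubtrees s V)
                       {x y : Fin n} (x-root : IsRoot s x) (y-root : IsRoot s y) (x≢y : x ≢ y)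
                       (y≤x : ∣ V y ∣ ≤ ∣ V x ∣) where
    open ReferenceSubtrees inv

    private
      s′ : Forest n
      s′ = link s x y

      V′ : Fin n → NodeSet n
      V′ = merge V x y

    merge-at : V′ x ≡ V x ∪ V y
    merge-at with x ≟ x
    ... | yes _   = refl
    ... | no  x≢x = ⊥-elim (x≢x refl)

    merge-off : ∀ {z} → z ≢ x → V′ z ≡ V z
    merge-off {z} z≢x with z ≟ x
    ... | yes z≡x = ⊥-elim (z≢x z≡x)
    ... | no  _   = refl

    merge-⊇ : ∀ z → V z ⊆ V′ z
    merge-⊇ z with z ≟ x
    ... | yes refl = ∪-⊇ˡ {X = V z} {V y}
    ... | no  _    = id

    link-at : s′ y ≡ x
    link-at with y ≟ y
    ... | yes _   = refl
    ... | no  y≢y = ⊥-elim (y≢y refl)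

    link-off : ∀ {z} → z ≢ y → s′ z ≡ s z
    link-off {z} z≢y with z ≟ y
    ... | yes z≡y = ⊥-elim (z≢y z≡y)
    ... | no  _   = refl

    y≢x : y ≢ x
    y≢x = x≢y ∘ sym

    y≪merged : V y ≪ V x ∪ V y
    y≪merged = ∪-⊇ʳ {X = V x} {V y} , (begin
      2 * ∣ V y ∣         ≡⟨ cong (∣ V y ∣ +_) (ℕP.+-identityʳ ∣ V y ∣) ⟩
      ∣ V y ∣ + ∣ V y ∣   ≤⟨ ℕP.+-monoˡ-≤ ∣ V y ∣ y≤x ⟩
      ∣ V x ∣ + ∣ V y ∣   ≡⟨ ∣∪∣ {X = V x} {V y} (roots-disjoint x-root y-root x≢y) ⟨
      ∣ V x ∪ V y ∣       ∎)
      where open ℕP.≤-Reasoning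

    parent-≪′ : ∀ {z} → s′ z ≢ z → V′ z ≪ V′ (s′ z)
    parent-≪′ {z} moved with z ≟ y
    ... | yes refl rewrite merge-at | merge-off y≢x = y≪merged
    ... | no  z≢y = subst (_≪ V′ (s z)) (sym (merge-off z≢x)) (≪-⊆-trans (parent-≪ moved) (merge-⊇ (s z)))
      where
      z≢x : z ≢ x
      z≢x refl = moved x-root

    doubling′ : Doubling s′ V′
    doubling′ = record { self = λ z → merge-⊇ z (self z) ; parent-≪ = parent-≪′ }

    root-kept : ∀ {r} → IsRoot s′ r → r ≢ y × IsRoot s r
    root-kept {r} r-root = cases (r ≟ y)
      where
      cases : Dec (r ≡ y) → r ≢ y × IsRoot s r
      cases (yes refl) = ⊥-elim (x≢y (trans (sym link-at) r-root))
      cases (no  r≢y)  = r≢y , trans (sym (link-off r≢y)) r-root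

    redirect : Fin n → Fin n
    redirect r = if ⌊ r ≟ y ⌋ then x else r

    redirect-at : redirect y ≡ x
    redirect-at with y ≟ y
    ... | yes _   = refl
    ... | no  y≢y = ⊥-elim (y≢y refl)

    redirect-off : ∀ {r} → r ≢ y → redirect r ≡ r
    redirect-off {r} r≢y with r ≟ y
    ... | yes r≡y = ⊥-elim (r≢y r≡y)
    ... | no  _   = refl

    root-linked : ∀ q → root s′ q ≡ redirect (root s q)
    root-linked = DoublingProperties.root-unique doubling′ (redirect ∘ root s) parent-case root-case
      where
      parent-case : ∀ z → redirect (root s (s′ z)) ≡ redirect (root s z)
      parent-case z with z ≟ y
      ... | yes refl = begin
        redirect (root s x) ≡⟨ cong redirect (iter-root s x-root n) ⟩
        redirect x          ≡⟨ redirect-off x≢y ⟩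
        x                   ≡⟨ redirect-at ⟨
        redirect y          ≡⟨ cong redirect (iter-root s y-root n) ⟨
        redirect (root s y) ∎
        where open ≡-Reasoning
      ... | no  z≢y  = cong redirect (root-parent z)
      root-case : ∀ {r} → IsRoot s′ r → redirect (root s r) ≡ r
      root-case r-root with r≢y , r-root-s ← root-kept r-root =
        trans (cong redirect (iter-root s r-root-s n)) (redirect-off r≢y)

    root-owns′ : ∀ {r q} → IsRoot s′ r → q ∈ₛ V′ r → root s′ q ≡ r
    root-owns′ {r} {q} r-root q∈r = trans (root-linked q) (owner (r ≟ x))
      where
      owner : Dec (r ≡ x) → redirect (root s q) ≡ r
      owner (yes refl) with ∪-cases {X = V x} {V y} (subst (λ X → q ∈ₛ X) merge-at q∈r)
      ... | inj₁ q∈x = trans (cong redirect (root-owns x-root q∈x)) (redirect-off x≢y)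
      ... | inj₂ q∈y = trans (cong redirect (root-owns y-root q∈y)) redirect-at
      owner (no r≢x) with r≢y , r-root-s ← root-kept r-root =
        trans (cong redirect (root-owns r-root-s (subst (λ X → q ∈ₛ X) (merge-off r≢x) q∈r))) (redirect-off r≢y)

    merged-nested : ∀ {v} → v ≢ x → Nested (V x ∪ V y) (V v)
    merged-nested {v} v≢x with v ≟ y
    ... | yes refl = inj₂ (inj₂ y≪merged)
    ... | no  v≢y with nested v≢y
    ...   | inj₂ (inj₁ v≪y) = inj₂ (inj₂ (≪-⊆-trans v≪y (∪-⊇ʳ {X = V x} {V y})))
    ...   | inj₂ (inj₂ y≪v) = ⊥-elim (root-maximal y-root y≪v)
    ...   | inj₁ v∩y≡∅ with nested v≢x
    ...     | inj₂ (inj₁ v≪x) = inj₂ (inj₂ (≪-⊆-trans v≪x (∪-⊇ˡ {X = V x} {V y})))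
    ...     | inj₂ (inj₂ x≪v) = ⊥-elim (root-maximal x-root x≪v)
    ...     | inj₁ v∩x≡∅      =
      inj₁ (λ q∈xy q∈v → [ v∩x≡∅ q∈v , v∩y≡∅ q∈v ] (∪-cases {X = V x} {V y} q∈xy))

    nested′ : ∀ {u v} → u ≢ v → Nested (V′ u) (V′ v)
    nested′ {u} {v} u≢v with u ≟ x | v ≟ x
    ... | yes refl | yes refl = ⊥-elim (u≢v refl)
    ... | yes refl | no  v≢x  = merged-nested v≢x
    ... | no  u≢x  | yes refl = Nested-sym (merged-nested u≢x)
    ... | no  u≢x  | no  v≢x  = nested u≢v

    link-preserves : ReferenceSubtrees s′ V′
    link-preserves = record { doubling = doubling′ ; root-owns = root-owns′ ; nested = nested′ }

  unionStep-preserves : ∀ {n} {s : Forest n} {V} → ReferenceSubtrees s V →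
                        ∀ {ra rb} → IsRoot s ra → IsRoot s rb → ra ≢ rb →
                        ∃[ V′ ] ReferenceSubtrees (unionStep s ra rb) V′ × (∀ z → V z ⊆ V′ z)
  unionStep-preserves {s = s} {V} inv {ra} {rb} a-root b-root a≢b with size s ra <ᵇ size s rb in cmp
  ... | true  = merge V rb ra , link-preserves , merge-⊇
    where
    a≤b : ∣ V ra ∣ ≤ ∣ V rb ∣
    a≤b = ReferenceSubtrees.∣∣-≤-size inv a-root b-root (ℕP.<⇒≤ (ℕP.<ᵇ⇒< _ _ (Equivalence.from T-≡ cmp)))
    open LinkPreserves inv b-root a-root (a≢b ∘ sym) a≤b
  ... | false = merge V ra rb , link-preserves , merge-⊇
    where
    b≤a : ∣ V rb ∣ ≤ ∣ V ra ∣
    b≤a = ReferenceSubtrees.∣∣-≤-size inv b-root a-root (ℕP.≮⇒≥ (subst T cmp ∘ ℕP.<⇒<ᵇ))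
    open LinkPreserves inv a-root b-root a≢b b≤a

  singletons : ∀ {n} → Fin n → NodeSet n
  singletons p q = ⌊ p ≟ q ⌋

  initial-reference : ∀ n → ReferenceSubtrees (initial n) singletons
  initial-reference n = record
    { doubling  = record { self = λ _ → fromWitness refl ; parent-≪ = λ moved → ⊥-elim (moved refl) }
    ; root-owns = λ _ q∈r → trans (iter-root (initial n) refl n) (sym (toWitness q∈r))
    ; nested    = λ x≢y → inj₁ (λ q∈x q∈y → x≢y (trans (toWitness q∈x) (sym (toWitness q∈y))))
    }

  module _ {n} {s : Forest n} where

    step-preserves : ∀ {V} → ReferenceSubtrees s V → ∀ o {ops} → Valid s (o ∷ ops) →
                     ∃[ V′ ] ReferenceSubtrees (step s o) V′ × (∀ z → V z ⊆ V′ z)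
    step-preserves {V} inv (find p) _                             = V , findStep-preserves inv p , λ _ → id
    step-preserves inv (union ra rb) (a-root , b-root , a≢b , _) = unionStep-preserves inv a-root b-root a≢b

    Valid-tail : ∀ o {ops} → Valid s (o ∷ ops) → Valid (step s o) ops
    Valid-tail (find p)      valid             = valid
    Valid-tail (union ra rb) (_ , _ , _ , valid) = valid

  everDescendant : ∀ {n} → Forest n → List (Op n) → Fin n → NodeSet n
  everDescendant s ops p q = any (λ t → isDesc t p q) (trajectory s ops)

  record Cover {n} (s : Forest n) (ops : List (Op n)) (V : Fin n → NodeSet n) : Set where
    field
      {final}   : Forest n
      sets      : Fin n → NodeSet n
      reference : ReferenceSubtrees final sets
      extends   : ∀ p → V p ⊆ sets p
      covers    : ∀ p → everDescendant s ops p ⊆ sets p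

  run : ∀ {n} {s : Forest n} {V} → ReferenceSubtrees s V → ∀ ops → Valid s ops → Cover s ops V
  run {V = V} inv [] _ = record
    { sets = V ; reference = inv ; extends = λ _ → id
    ; covers = λ p {q} desc → [ isDesc⇒∈ {p} {q} , (λ ()) ] (Equivalence.to T-∨ desc) }
    where open ReferenceSubtrees inv
  run {V = V} inv (o ∷ ops) valid with V′ , inv′ , V⊆V′ ← step-preserves inv o valid = record
    { sets = sets ; reference = reference ; extends = λ p → extends p ∘ V⊆V′ p
    ; covers = λ p {q} desc → [ extends p ∘ V⊆V′ p ∘ isDesc⇒∈ {p} {q} , covers p ] (Equivalence.to T-∨ desc) }
    where
    open ReferenceSubtrees inv using (isDesc⇒∈)
    open Cover (run inv′ ops (Valid-tail o valid))

module Arithmetic where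

  open import Data.Bool using (Bool; if_then_else_)
  open import Data.Empty using (⊥-elim)
  open import Data.List using ([]; _∷_; length; map)
  open import Data.Nat as ℕ using (ℕ; zero; suc; _+_; _*_; _∸_; _^_; _≤_; _<_; z≤n; s≤s; ⌊_/2⌋; NonZero)
  open import Data.Nat.DivMod using (_/_; _%_; m≡m%n+[m/n]*n; m%n<n; m*n/n≡m; /-monoˡ-≤; m/n*n≤m; n/1≡n)
  open import Data.Nat.ListAction using (sum)
  open import Data.Nat.Logarithm using (⌊log₂_⌋; ⌊log₂⌋-mono-≤; ⌊log₂[2^n]⌋≡n; ⌊log₂⌊n/2⌋⌋≡⌊log₂n⌋∸1)
  open import Data.Nat.Properties as ℕP using (≤-refl; ≤-trans; ≤-reflexive)
  open import Data.Nat.Tactic.RingSolver using (solve-∀)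
  open import Data.Sum using (inj₁; inj₂)
  open import Function using (_∘_)
  open import Relation.Nullary using (Dec; yes; no)
  open import Relation.Nullary.Decidable using (⌊_⌋)
  open ReferenceForest using (countIn)

  <2^suc⌊log₂⌋ : ∀ x → x < 2 ^ suc ⌊log₂ x ⌋
  <2^suc⌊log₂⌋ x = ℕP.≰⇒> λ 2^≤x → ℕP.1+n≰n (begin
    suc ⌊log₂ x ⌋              ≡⟨ ⌊log₂[2^n]⌋≡n (suc ⌊log₂ x ⌋) ⟨
    ⌊log₂ 2 ^ suc ⌊log₂ x ⌋ ⌋  ≤⟨ ⌊log₂⌋-mono-≤ 2^≤x ⟩
    ⌊log₂ x ⌋                  ∎)
    where open ℕP.≤-Reasoning

  2*⌊n/2⌋≤n : ∀ n → 2 * ⌊ n /2⌋ ≤ n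
  2*⌊n/2⌋≤n n = begin
    2 * ⌊ n /2⌋           ≡⟨ cong (⌊ n /2⌋ +_) (ℕP.+-identityʳ ⌊ n /2⌋) ⟩
    ⌊ n /2⌋ + ⌊ n /2⌋     ≤⟨ ℕP.+-monoʳ-≤ ⌊ n /2⌋ (ℕP.⌊n/2⌋≤⌈n/2⌉ n) ⟩
    ⌊ n /2⌋ + ℕ.⌈ n /2⌉   ≡⟨ ℕP.⌊n/2⌋+⌈n/2⌉≡n n ⟩
    n                     ∎
    where open ℕP.≤-Reasoning

  2^⌊log₂⌋≤ : ∀ {x} → 1 ≤ x → 2 ^ ⌊log₂ x ⌋ ≤ x
  2^⌊log₂⌋≤ = go _ refl
    where
    go : ∀ k {x} → ⌊log₂ x ⌋ ≡ k → 1 ≤ x → 2 ^ k ≤ x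
    go zero    _ 1≤x = 1≤x
    go (suc k) {suc (suc x)} log≡ _ = begin
      2 * 2 ^ k               ≤⟨ ℕP.*-monoʳ-≤ 2 (go k half-log≡ (s≤s z≤n)) ⟩
      2 * ⌊ 2 + x /2⌋         ≤⟨ 2*⌊n/2⌋≤n (2 + x) ⟩
      2 + x                   ∎
      where
      open ℕP.≤-Reasoning
      half-log≡ : ⌊log₂ ⌊ 2 + x /2⌋ ⌋ ≡ k
      half-log≡ = trans (⌊log₂⌊n/2⌋⌋≡⌊log₂n⌋∸1 (2 + x)) (cong (_∸ 1) log≡)

  m<[m/n+1]*n : ∀ m n .{{_ : NonZero n}} → m < (m / n + 1) * n
  m<[m/n+1]*n m n = begin-strict
    m                   ≡⟨ m≡m%n+[m/n]*n m n ⟩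
    m % n + m / n * n   <⟨ ℕP.+-monoˡ-< (m / n * n) (m%n<n m n) ⟩
    n + m / n * n       ≡⟨ ℕP.+-comm n (m / n * n) ⟩
    m / n * n + n       ≡⟨ cong (m / n * n +_) (ℕP.*-identityˡ n) ⟨
    m / n * n + 1 * n   ≡⟨ ℕP.*-distribʳ-+ n (m / n) 1 ⟨
    (m / n + 1) * n     ∎
    where open ℕP.≤-Reasoning

  *≤⇒≤/ : ∀ {a m} n .{{_ : NonZero n}} → a * n ≤ m → a ≤ m / n
  *≤⇒≤/ {a} n a*n≤m = ≤-trans (≤-reflexive (sym (m*n/n≡m a n))) (/-monoˡ-≤ n a*n≤m)

  sumBelow : ℕ → (ℕ → ℕ) → ℕ
  sumBelow zero    f = 0
  sumBelow (suc K) f = sumBelow K f + f K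

  module _ {f g : ℕ → ℕ} where

    sumBelow-mono : (∀ k → f k ≤ g k) → ∀ K → sumBelow K f ≤ sumBelow K g
    sumBelow-mono f≤g zero    = z≤n
    sumBelow-mono f≤g (suc K) = ℕP.+-mono-≤ (sumBelow-mono f≤g K) (f≤g K)

    sumBelow-cong : (∀ k → f k ≡ g k) → ∀ K → sumBelow K f ≡ sumBelow K g
    sumBelow-cong f≡g zero    = refl
    sumBelow-cong f≡g (suc K) = cong₂ _+_ (sumBelow-cong f≡g K) (f≡g K)

    sumBelow-+ : ∀ K → sumBelow K (λ k → f k + g k) ≡ sumBelow K f + sumBelow K g
    sumBelow-+ zero    = refl
    sumBelow-+ (suc K) rewrite sumBelow-+ K = interchange (sumBelow K f) (sumBelow K g) (f K) (g K)
      where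
      interchange : ∀ a b c d → a + b + (c + d) ≡ a + c + (b + d)
      interchange = solve-∀

  sumBelow-0 : ∀ K → sumBelow K (λ _ → 0) ≡ 0
  sumBelow-0 zero    = refl
  sumBelow-0 (suc K) = cong (_+ 0) (sumBelow-0 K)

  indicator : ℕ → ℕ → ℕ
  indicator l k = if ⌊ l ℕ.≟ k ⌋ then 1 else 0

  sumBelow-indicator-vanishes : ∀ (G : ℕ → ℕ) {l} K → K ≤ l → sumBelow K (λ k → G k * indicator l k) ≡ 0
  sumBelow-indicator-vanishes G     zero    _     = refl
  sumBelow-indicator-vanishes G {l} (suc K) 1+K≤l with l ℕ.≟ K
  ... | yes refl = ⊥-elim (ℕP.<-irrefl refl 1+K≤l)
  ... | no  _    = cong₂ _+_ (sumBelow-indicator-vanishes G K (ℕP.<⇒≤ 1+K≤l)) (ℕP.*-zeroʳ (G K))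

  sumBelow-indicator : ∀ (G : ℕ → ℕ) {l} K → l < K → sumBelow K (λ k → G k * indicator l k) ≡ G l
  sumBelow-indicator G {l} (suc K) (s≤s l≤K) with l ℕ.≟ K
  ... | yes refl = cong₂ _+_ (sumBelow-indicator-vanishes G K ≤-refl) (ℕP.*-identityʳ (G l))
  ... | no  l≢K  =
    trans (cong₂ _+_ (sumBelow-indicator G K (ℕP.≤∧≢⇒< l≤K l≢K)) (ℕP.*-zeroʳ (G K))) (ℕP.+-identityʳ (G l))

  atLevel : ∀ {A : Set} → (A → ℕ) → ℕ → A → Bool
  atLevel level k a = ⌊ level a ℕ.≟ k ⌋

  countIn-atLevel-∷ : ∀ {A : Set} (level : A → ℕ) k a xs →
                      countIn (a ∷ xs) (atLevel level k) ≡ indicator (level a) k + countIn xs (atLevel level k)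
  countIn-atLevel-∷ level k a xs with level a ℕ.≟ k
  ... | yes _ = refl
  ... | no  _ = refl

  sum-by-level : ∀ {A : Set} (level : A → ℕ) (G : ℕ → ℕ) K → (∀ a → level a < K) →
                 ∀ xs → sum (map (G ∘ level) xs) ≡ sumBelow K (λ k → G k * countIn xs (atLevel level k))
  sum-by-level level G K level<K []       = sym (trans (sumBelow-cong (λ k → ℕP.*-zeroʳ (G k)) K) (sumBelow-0 K))
  sum-by-level level G K level<K (a ∷ xs) = begin
    G (level a) + sum (map (G ∘ level) xs)
      ≡⟨ cong₂ _+_ (sumBelow-indicator G K (level<K a)) (sym (sum-by-level level G K level<K xs)) ⟨
    sumBelow K (λ k → G k * indicator (level a) k) + sumBelow K (λ k → G k * countIn xs (atLevel level k))
      ≡⟨ sumBelow-+ K ⟨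
    sumBelow K (λ k → G k * indicator (level a) k + G k * countIn xs (atLevel level k))
      ≡⟨ sumBelow-cong (λ k → trans (cong (G k *_) (countIn-atLevel-∷ level k a xs)) (ℕP.*-distribˡ-+ (G k) _ _)) K ⟨
    sumBelow K (λ k → G k * countIn (a ∷ xs) (atLevel level k))
      ∎
    where open ≡-Reasoning

  sum-map-+const : ∀ {A : Set} (f : A → ℕ) c xs → sum (map (λ a → f a + c) xs) ≡ sum (map f xs) + length xs * c
  sum-map-+const f c []       = refl
  sum-map-+const f c (x ∷ xs) rewrite sum-map-+const f c xs = regroup (f x) c (sum (map f xs)) (length xs * c)
    where
    regroup : ∀ a c s t → a + c + (s + t) ≡ a + s + (c + t)
    regroup = solve-∀

  -- the rounded-down form of 1 / (a (a + 1)) = 1 / a − 1 / (a + 1)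
  telescope-step : ∀ A a → A / (suc a * suc (suc a)) + A / suc (suc a) ≤ A / suc a
  telescope-step A a = *≤⇒≤/ (suc a) (begin
    (t + v) * suc a     ≡⟨ ℕP.*-distribʳ-+ (suc a) t v ⟩
    t * suc a + v * suc a ≤⟨ ℕP.+-monoˡ-≤ (v * suc a) (ℕP.≤-pred (subst (t * suc a <_) (ℕP.+-comm v 1) t*[a+1]<v+1)) ⟩
    v + v * suc a       ≡⟨ ℕP.*-suc v (suc a) ⟨
    v * suc (suc a)     ≤⟨ m/n*n≤m A (suc (suc a)) ⟩
    A                   ∎)
    where
    open ℕP.≤-Reasoning
    t v : ℕ
    t = A / (suc a * suc (suc a))
    v = A / suc (suc a)
    t*[a+1]<v+1 : t * suc a < v + 1
    t*[a+1]<v+1 = ℕP.*-cancelʳ-< (suc (suc a)) (t * suc a) (v + 1) (begin-strict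
      t * suc a * suc (suc a)     ≡⟨ ℕP.*-assoc t (suc a) (suc (suc a)) ⟩
      t * (suc a * suc (suc a))   ≤⟨ m/n*n≤m A (suc a * suc (suc a)) ⟩
      A                           <⟨ m<[m/n+1]*n A (suc (suc a)) ⟩
      (v + 1) * suc (suc a)       ∎)

  telescope : ∀ A K → sumBelow K (λ k → A / (suc k * suc (suc k))) + A / suc K ≤ A
  telescope A zero    = ≤-reflexive (n/1≡n A)
  telescope A (suc K) = begin
    sumBelow K f + f K + A / suc (suc K)     ≡⟨ ℕP.+-assoc (sumBelow K f) (f K) _ ⟩
    sumBelow K f + (f K + A / suc (suc K))   ≤⟨ ℕP.+-monoʳ-≤ (sumBelow K f) (telescope-step A K) ⟩
    sumBelow K f + A / suc K                 ≤⟨ telescope A K ⟩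
    A                                        ∎
    where
    open ℕP.≤-Reasoning
    f : ℕ → ℕ
    f k = A / (suc k * suc (suc k))

  square-suc≤2*square : ∀ {m} → 3 ≤ m → suc m * suc m ≤ 2 * (m * m)
  square-suc≤2*square {suc (suc (suc t))} (s≤s (s≤s (s≤s z≤n))) =
    ≤-trans (ℕP.m≤m+n ((4 + t) * (4 + t)) (t * t + 4 * t + 2)) (≤-reflexive (identity t))
    where
    identity : ∀ t → (4 + t) * (4 + t) + (t * t + 4 * t + 2) ≡ 2 * ((3 + t) * (3 + t))
    identity = solve-∀

  -- the ratio 2 ^ j / (j + 1)² is nondecreasing for j ≥ 2
  pow/square-mono : ∀ {j} m → 2 ≤ j → j ≤ m → 2 ^ j * (suc m * suc m) ≤ 2 ^ m * (suc j * suc j)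
  pow/square-mono {j} (suc m) 2≤j j≤1+m with ℕP.m≤n⇒m<n∨m≡n j≤1+m
  ... | inj₂ refl = ≤-refl
  ... | inj₁ j≤m  = begin
    2 ^ j * (suc (suc m) * suc (suc m)) ≤⟨ ℕP.*-monoʳ-≤ (2 ^ j) (square-suc≤2*square (s≤s (≤-trans 2≤j j≤m′))) ⟩
    2 ^ j * (2 * (suc m * suc m))       ≡⟨ swap (2 ^ j) (suc m * suc m) ⟩
    2 * (2 ^ j * (suc m * suc m))       ≤⟨ ℕP.*-monoʳ-≤ 2 (pow/square-mono m 2≤j j≤m′) ⟩
    2 * (2 ^ m * (suc j * suc j))       ≡⟨ ℕP.*-assoc 2 (2 ^ m) _ ⟨
    2 ^ suc m * (suc j * suc j)         ∎
    where
    open ℕP.≤-Reasoning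
    j≤m′ : j ≤ m
    j≤m′ = ℕP.≤-pred j≤m
    swap : ∀ a b → a * (2 * b) ≡ 2 * (a * b)
    swap = solve-∀
  pow/square-mono {suc (suc j)} zero 2≤j ()

  levelWeight : ℕ → ℕ
  levelWeight k = 2 ^ suc k / (suc k * suc k)

  -- The + 4 absorbs the levels j ≤ 1, below the range of pow/square-mono, and the rounding in levelWeight.
  numerator-bound : ∀ {x y} → x ≤ y → x ≤ (levelWeight ⌊log₂ y ⌋ + 4) * (suc ⌊log₂ x ⌋ * suc ⌊log₂ x ⌋)
  numerator-bound {x} {y} x≤y = by-level (j ℕ.≤? 1)
    where
    open ℕP.≤-Reasoning
    j k J K : ℕ
    j = ⌊log₂ x ⌋
    k = ⌊log₂ y ⌋
    J = suc j
    K = suc k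

    x<[w+1]*J² : 2 ≤ j → x < (levelWeight k + 1) * (J * J)
    x<[w+1]*J² 2≤j = ℕP.*-cancelʳ-< (K * K) x ((levelWeight k + 1) * (J * J)) (begin-strict
      x * (K * K)                              <⟨ ℕP.*-monoˡ-< (K * K) (<2^suc⌊log₂⌋ x) ⟩
      2 * 2 ^ j * (K * K)                      ≡⟨ ℕP.*-assoc 2 (2 ^ j) (K * K) ⟩
      2 * (2 ^ j * (K * K))                    ≤⟨ ℕP.*-monoʳ-≤ 2 (pow/square-mono k 2≤j (⌊log₂⌋-mono-≤ x≤y)) ⟩
      2 * (2 ^ k * (J * J))                    ≡⟨ ℕP.*-assoc 2 (2 ^ k) (J * J) ⟨
      2 ^ K * (J * J)                          ≤⟨ ℕP.*-monoˡ-≤ (J * J) (ℕP.<⇒≤ (m<[m/n+1]*n (2 ^ K) (K * K))) ⟩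
      (levelWeight k + 1) * (K * K) * (J * J)  ≡⟨ rearrange (levelWeight k + 1) (K * K) (J * J) ⟩
      (levelWeight k + 1) * (J * J) * (K * K)  ∎)
      where
      rearrange : ∀ a b c → a * b * c ≡ a * c * b
      rearrange = solve-∀

    by-level : Dec (j ≤ 1) → x ≤ (levelWeight k + 4) * (J * J)
    by-level (yes j≤1) = begin
      x                              ≤⟨ ℕP.<⇒≤ (<2^suc⌊log₂⌋ x) ⟩
      2 ^ J                          ≤⟨ ℕP.^-monoʳ-≤ 2 (s≤s j≤1) ⟩
      4                              ≤⟨ ℕP.m≤m*n 4 (J * J) ⟩
      4 * (J * J)                    ≤⟨ ℕP.*-monoˡ-≤ (J * J) (ℕP.m≤n+m 4 (levelWeight k)) ⟩
      (levelWeight k + 4) * (J * J)  ∎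
    by-level (no j≰1)  = begin
      x                              <⟨ x<[w+1]*J² (ℕP.≰⇒> j≰1) ⟩
      (levelWeight k + 1) * (J * J)  ≤⟨ ℕP.*-monoˡ-≤ (J * J) (ℕP.+-monoʳ-≤ (levelWeight k) (s≤s z≤n)) ⟩
      (levelWeight k + 4) * (J * J)  ∎

  levelWeight-share : ∀ k {c N} → c * 2 ^ k ≤ N → levelWeight k * c ≤ 4 * N / (suc k * suc (suc k))
  levelWeight-share k {c} {N} c*2^k≤N = *≤⇒≤/ (K * suc K) (begin
    w * c * (K * suc K)        ≤⟨ ℕP.*-monoʳ-≤ (w * c) (ℕP.*-monoʳ-≤ K (ℕP.+-monoˡ-≤ K (s≤s z≤n))) ⟩
    w * c * (K * (K + K))      ≡⟨ regroup w c K ⟩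
    2 * (w * (K * K) * c)      ≤⟨ ℕP.*-monoʳ-≤ 2 (ℕP.*-monoˡ-≤ c (m/n*n≤m (2 ^ K) (K * K))) ⟩
    2 * (2 ^ K * c)            ≡⟨ regroup′ (2 ^ k) c ⟩
    4 * (c * 2 ^ k)            ≤⟨ ℕP.*-monoʳ-≤ 4 c*2^k≤N ⟩
    4 * N                      ∎)
    where
    open ℕP.≤-Reasoning
    K w : ℕ
    K = suc k
    w = levelWeight k
    regroup : ∀ a b c → a * b * (c * (c + c)) ≡ 2 * (a * (c * c) * b)
    regroup = solve-∀
    regroup′ : ∀ a b → 2 * ((2 * a) * b) ≡ 4 * (b * a)
    regroup′ = solve-∀

open ReferenceForest
open Arithmetic

module Levels {n} (V : Fin n → NodeSet n) (self : ∀ x → x ∈ₛ V x)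
              (nested : ∀ {x y} → x ≢ y → Nested (V x) (V y)) where

  open import Data.Bool using (T?)
  open import Data.Bool.ListAction using (any)
  open import Data.Empty using (⊥-elim)
  open import Data.List using (List; []; _∷_; length; filter; allFin; map)
  open import Data.List.Relation.Unary.All as All using (All; []; _∷_)
  open import Data.List.Relation.Unary.All.Properties using (all-filter)
  open import Data.List.Relation.Unary.AllPairs using (AllPairs; []; _∷_)
  open import Data.List.Relation.Unary.Unique.Propositional.Properties using (allFin⁺) renaming (filter⁺ to unique-filter⁺)
  open import Data.Nat as ℕ using (ℕ; suc; _+_; _*_; _^_; _≤_; _<_; z≤n; s≤s)
  open import Data.Nat.DivMod using (_/_)
  open import Data.Nat.ListAction using (sum)
  open import Data.Nat.Logarithm using (⌊log₂_⌋; ⌊log₂⌋-mono-≤; ⌊log₂[2*b]⌋≡1+⌊log₂b⌋)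
  open import Data.Nat.Properties as ℕP using (≤-trans)
  open import Data.Nat.Tactic.RingSolver using (solve-∀)
  open import Data.List.Properties using (length-tabulate)
  open import Data.Product using (_,_)
  open import Data.Sum using (inj₁; inj₂; [_,_])
  open import Function using (_∘_; id)
  open import Relation.Nullary.Decidable using (toWitness)

  ⋃ : List (Fin n) → NodeSet n
  ⋃ ps q = any (λ p → V p q) ps

  PairwiseDisjoint : List (Fin n) → Set
  PairwiseDisjoint = AllPairs (λ p p′ → Disjoint (V p) (V p′))

  disjoint-⋃ : ∀ {X} ps → All (λ p → Disjoint X (V p)) ps → Disjoint X (⋃ ps)
  disjoint-⋃ (p ∷ ps) (X∩p≡∅ ∷ rest) q∈X q∈⋃ =
    [ X∩p≡∅ q∈X , disjoint-⋃ ps rest q∈X ] (∪-cases {X = V p} {⋃ ps} q∈⋃)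

  ∣⋃∣-≥ : ∀ {m} ps → PairwiseDisjoint ps → All (λ p → m ≤ ∣ V p ∣) ps → length ps * m ≤ ∣ ⋃ ps ∣
  ∣⋃∣-≥         []       []                _               = z≤n
  ∣⋃∣-≥ {m} (p ∷ ps) (p-disj ∷ disj) (m≤p ∷ m≤ps) = begin
    m + length ps * m       ≤⟨ ℕP.+-mono-≤ m≤p (∣⋃∣-≥ ps disj m≤ps) ⟩
    ∣ V p ∣ + ∣ ⋃ ps ∣      ≡⟨ ∣∪∣ {X = V p} {⋃ ps} (disjoint-⋃ ps p-disj) ⟨
    ∣ ⋃ (p ∷ ps) ∣          ∎
    where open ℕP.≤-Reasoning

  level : Fin n → ℕ
  level p = ⌊log₂ ∣ V p ∣ ⌋

  ≪-raises-level : ∀ {p p′} → V p ≪ V p′ → level p < level p′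
  ≪-raises-level {p} {p′} (_ , 2p≤p′) = begin
    suc (level p)           ≡⟨ ⌊log₂[2*b]⌋≡1+⌊log₂b⌋ ∣ V p ∣ {{ℕ.>-nonZero (∣∣-pos (V p) (self p))}} ⟨
    ⌊log₂ 2 * ∣ V p ∣ ⌋     ≤⟨ ⌊log₂⌋-mono-≤ 2p≤p′ ⟩
    level p′                ∎
    where open ℕP.≤-Reasoning

  same-level-disjoint : ∀ {p p′} → p ≢ p′ → level p ≡ level p′ → Disjoint (V p) (V p′)
  same-level-disjoint p≢p′ same with nested p≢p′
  ... | inj₁ disj         = disj
  ... | inj₂ (inj₁ p≪p′) = ⊥-elim (ℕP.<-irrefl same (≪-raises-level p≪p′))
  ... | inj₂ (inj₂ p′≪p) = ⊥-elim (ℕP.<-irrefl (sym same) (≪-raises-level p′≪p))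

  level-count : ∀ k → count (atLevel level k) * 2 ^ k ≤ n
  level-count k = ≤-trans (∣⋃∣-≥ ps (pairwise (unique-filter⁺ _ (allFin⁺ n)) at-k) big) (∣∣≤n (⋃ ps))
    where
    ps : List (Fin n)
    ps = filter (λ p → T? (atLevel level k p)) (allFin n)
    at-k : All (λ p → level p ≡ k) ps
    at-k = All.map toWitness (all-filter _ (allFin n))
    pairwise : ∀ {ps} → AllPairs _≢_ ps → All (λ p → level p ≡ k) ps → PairwiseDisjoint ps
    pairwise []             []            = []
    pairwise (p≢ps ∷ rest) (p-at ∷ ps-at) =
      All.zipWith (λ (p≢p′ , p′-at) {q} → same-level-disjoint p≢p′ (trans p-at (sym p′-at)) {q}) (p≢ps , ps-at)
        ∷ pairwise rest ps-at
    big : All (λ p → 2 ^ k ≤ ∣ V p ∣) ps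
    big = All.map (λ {p} p-at → subst (λ j → 2 ^ j ≤ ∣ V p ∣) p-at (2^⌊log₂⌋≤ (∣∣-pos (V p) (self p)))) at-k

  level-weight-sum : sum (map (levelWeight ∘ level) (allFin n)) ≤ 4 * n
  level-weight-sum = begin
    sum (map (levelWeight ∘ level) (allFin n))
      ≡⟨ sum-by-level level levelWeight K level<K (allFin n) ⟩
    sumBelow K (λ k → levelWeight k * count (atLevel level k))
      ≤⟨ sumBelow-mono (λ k → levelWeight-share k (level-count k)) K ⟩
    sumBelow K (λ k → 4 * n / (suc k * suc (suc k)))
      ≤⟨ ℕP.m≤m+n _ _ ⟩
    sumBelow K (λ k → 4 * n / (suc k * suc (suc k))) + 4 * n / suc K
      ≤⟨ telescope (4 * n) K ⟩
    4 * n ∎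
    where
    open ℕP.≤-Reasoning
    K : ℕ
    K = suc ⌊log₂ n ⌋
    level<K : ∀ p → level p < K
    level<K p = s≤s (⌊log₂⌋-mono-≤ (∣∣≤n (V p)))

  node-bound : Fin n → ℕ
  node-bound p = levelWeight (level p) + 4

  node-bound-sum : sum (map node-bound (allFin n)) ≤ 8 * n
  node-bound-sum = begin
    sum (map node-bound (allFin n))
      ≡⟨ sum-map-+const (levelWeight ∘ level) 4 (allFin n) ⟩
    sum (map (levelWeight ∘ level) (allFin n)) + length (allFin n) * 4
      ≤⟨ ℕP.+-mono-≤ level-weight-sum (ℕP.≤-reflexive (cong (_* 4) (length-tabulate {n = n} id))) ⟩
    4 * n + n * 4
      ≡⟨ regroup n ⟩
    8 * n
      ∎
    where
    open ℕP.≤-Reasoning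
    regroup : ∀ n → 4 * n + n * 4 ≡ 8 * n
    regroup = solve-∀

open import Data.Integer as ℤ using (+_)
import Data.Integer.Properties as ℤP
open import Data.List using (List; []; _∷_; foldr; map; allFin)
open import Data.Nat as ℕ using (ℕ; suc; _*_)
open import Data.Nat.ListAction using (sum)
import Data.Nat.Properties as ℕP
open import Data.Product using (∃-syntax; _,_)
open import Data.Rational using (ℚ; _≤_; _/_; _+_; 0ℚ; toℚᵘ)
import Data.Rational.Properties as ℚP
open import Data.Rational.Unnormalised as ℚᵘ using (ℚᵘ; mkℚᵘ; *≤*; *≡*)
import Data.Rational.Unnormalised.Properties as ℚᵘP

ι : ℕ → ℚ
ι m = + m / 1

private
  ιᵘ : ℕ → ℚᵘ
  ιᵘ m = mkℚᵘ (+ m) 0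

  toℚᵘ-ι : ∀ m → toℚᵘ (ι m) ℚᵘ.≃ ιᵘ m
  toℚᵘ-ι m = ℚP.toℚᵘ-fromℚᵘ (ιᵘ m)

  ιᵘ-homo-+ : ∀ a b → ιᵘ (a ℕ.+ b) ℚᵘ.≃ ιᵘ a ℚᵘ.+ ιᵘ b
  ιᵘ-homo-+ a b = *≡* (begin
    + (a ℕ.+ b) ℤ.* + 1                     ≡⟨ ℤP.*-identityʳ _ ⟩
    + (a ℕ.+ b)                             ≡⟨ ℤP.pos-+ a b ⟩
    + a ℤ.+ + b                             ≡⟨ cong₂ ℤ._+_ (ℤP.*-identityʳ (+ a)) (ℤP.*-identityʳ (+ b)) ⟨
    + a ℤ.* + 1 ℤ.+ + b ℤ.* + 1             ≡⟨ ℤP.*-identityʳ _ ⟨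
    (+ a ℤ.* + 1 ℤ.+ + b ℤ.* + 1) ℤ.* + 1   ∎)
    where open ≡-Reasoning

ι-homo-+ : ∀ a b → ι (a ℕ.+ b) ≡ ι a + ι b
ι-homo-+ a b = ℚP.toℚᵘ-injective (begin
  toℚᵘ (ι (a ℕ.+ b))          ≈⟨ toℚᵘ-ι (a ℕ.+ b) ⟩
  ιᵘ (a ℕ.+ b)                ≈⟨ ιᵘ-homo-+ a b ⟩
  ιᵘ a ℚᵘ.+ ιᵘ b              ≈⟨ ℚᵘP.+-cong (toℚᵘ-ι a) (toℚᵘ-ι b) ⟨
  toℚᵘ (ι a) ℚᵘ.+ toℚᵘ (ι b)  ≈⟨ ℚP.toℚᵘ-homo-+ (ι a) (ι b) ⟨
  toℚᵘ (ι a + ι b)            ∎)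
  where open ℚᵘP.≃-Reasoning

/≤ι : ∀ {x d M} → x ℕ.≤ M * suc d → + x / suc d ≤ ι M
/≤ι {x} {d} {M} x≤M*d = ℚP.toℚᵘ-cancel-≤
  (ℚᵘP.≤-respˡ-≃ (ℚᵘP.≃-sym (ℚP.toℚᵘ-fromℚᵘ (mkℚᵘ (+ x) d)))
  (ℚᵘP.≤-respʳ-≃ (ℚᵘP.≃-sym (toℚᵘ-ι M))
  (*≤* (subst₂ ℤ._≤_ (sym (ℤP.*-identityʳ (+ x))) (ℤP.pos-* M (suc d)) (ℤ.+≤+ x≤M*d)))))

ι-mono-≤ : ∀ {a b} → a ℕ.≤ b → ι a ≤ ι b
ι-mono-≤ {b = b} a≤b = /≤ι {d = 0} {M = b} (ℕP.≤-trans a≤b (ℕP.≤-reflexive (sym (ℕP.*-identityʳ b))))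

sum-≤-ι : ∀ {A : Set} (f : A → ℚ) (g : A → ℕ) → (∀ a → f a ≤ ι (g a)) →
          ∀ xs → foldr _+_ 0ℚ (map f xs) ≤ ι (sum (map g xs))
sum-≤-ι f g f≤g []       = ℚP.≤-refl
sum-≤-ι f g f≤g (a ∷ xs) rewrite ι-homo-+ (g a) (sum (map g xs)) = ℚP.+-mono-≤ (f≤g a) (sum-≤-ι f g f≤g xs)

potential≤8n : ∀ n ops → Valid (initial n) ops → potential (initial n) ops ≤ ι (8 * n)
potential≤8n n ops valid =
  ℚP.≤-trans (sum-≤-ι _ node-bound term-bound (allFin n)) (ι-mono-≤ node-bound-sum)
  where
  open Cover (run (initial-reference n) ops valid)
  open ReferenceSubtrees reference using (self; nested)
  open Levels sets self nested
  term-bound : ∀ p → term (sizeMax (initial n) ops p) ≤ ι (node-bound p)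
  term-bound p = /≤ι {M = node-bound p} (numerator-bound (∣∣-mono {X = everDescendant (initial n) ops p} (covers p)))

lemma4 : ∃[ C ] ∀ (n : ℕ) (ops : List (Op n)) → Valid (initial n) ops →
           potential (initial n) ops ≤ (+ (C * n)) / 1
lemma4 = 8 , potential≤8n
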